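{- Let $G=(V,V_0,V_1,E,c)$ be a parity game, $K\subseteq V$ a set of nodes all of color $c_K$, $p=c_K\bmod 2$, and let $U\subseteq V$ be a trap for player $p$. Then $\mathrm{MAttr}^G_p(K,c_K)\cap U\subseteq\mathrm{MAttr}^{G[U]}_p(K\cap U,c_K)$.
   Context: A parity game is a tuple $G=(V,V_0,V_1,E,c)$ where $V$ is a finite set of nodes partitioned into $V_0,V_1$, $E\subseteq V\times V$ with every node having a successor, and $c\colon V\to\mathbb{N}$. Let $v.E=\{w\mid(v,w)\in E\}$. For a game $H$ with nodes $V_H$, node sets $A,X$ and color $d$, let $\mathrm{mpre}^H_p(A,X,d)=\{v\in V_{H,p}\mid c(v)\geq d \wedge v.E_H\cap(A\cup X)\neq\emptyset\}\cup\{v\in V_{H,1-p}\mid c(v)\geq d\wedge v.E_H\subseteq A\cup X\}$ (successors taken in $H$), and let $\mathrm{MAttr}^H_p(X,d)$ be the least fixed point (over subsets of $V_H$) of $Z\mapsto\mathrm{mpre}^H_p(Z,X,d)$; the target $X$ is not included by default. A set $U\subseteq V$ is a trap for player $p$ if every $v\in V_p\cap U$ satisfies $v.E\subseteq U$ and every $v\in V_{1-p}\cap U$ satisfies $v.E\cap U\neq\emptyset$. $G[U]$ denotes the game with node set $U$ (ownership and colors inherited) and edge set $E\cap(U\times U)$. -}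

module Defs where

open import Data.Nat using (ℕ; _≥_)
open import Data.Fin using (Fin; zero; suc)
open import Data.Product using (Σ; ∃; _×_; _,_; proj₁; proj₂)
open import Data.Sum using (_⊎_; inj₁; inj₂)
open import Relation.Binary.PropositionalEquality using (_≡_; refl)
open import Relation.Unary using (Pred)
open import Level using (0ℓ)

Player : Set
Player = Fin 2

opp : Player → Player
opp zero = suc zero
opp (suc _) = zero

record Game (V : Set) : Set₁ where
  field
    owner : V → Player
    E     : V → V → Set
    c     : V → ℕ
    total : ∀ v → ∃ λ w → E v w
open Game public

NodeSet : Set → Set₁
NodeSet V = Pred V 0ℓ

mpre : {V : Set} → Game V → Player → NodeSet V → NodeSet V → ℕ → NodeSet V
mpre H p A X d v =
    (owner H v ≡ p × c H v ≥ d × (∃ λ w → E H v w × (A w ⊎ X w)))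
  ⊎ (owner H v ≡ opp p × c H v ≥ d × (∀ w → E H v w → A w ⊎ X w))

-- MAttr^H_p(X, d): least fixed point of Z ↦ mpre^H_p(Z, X, d),
-- realised as an inductive predicate (target X not included).
data MAttr {V : Set} (H : Game V) (p : Player) (X : NodeSet V) (d : ℕ) : NodeSet V where
  mattr : ∀ {v} → mpre H p (MAttr H p X d) X d v → MAttr H p X d v

IsTrap : {V : Set} → Game V → Player → NodeSet V → Set
IsTrap G p U =
    (∀ v → U v → owner G v ≡ p → ∀ w → E G v w → U w)
  × (∀ v → U v → owner G v ≡ opp p → ∃ λ w → E G v w × U w)

ownerCases : (a p : Player) → a ≡ p ⊎ a ≡ opp p
ownerCases zero zero = inj₁ refl
ownerCases zero (suc zero) = inj₂ refl
ownerCases (suc zero) zero = inj₂ refl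
ownerCases (suc zero) (suc zero) = inj₁ refl

trapSucc : {V : Set} (G : Game V) (p : Player) (U : NodeSet V) → IsTrap G p U →
           ∀ v → U v → ∃ λ w → E G v w × U w
trapSucc G p U (t₀ , t₁) v u with ownerCases (owner G v) p
... | inj₁ eq = let (w , e) = total G v in w , e , t₀ v u eq w e
... | inj₂ eq = t₁ v u eq

-- The subgame G[U] on nodes Σ V U (ownership, colours inherited,
-- edges E ∩ (U × U)); it is a game since U is a trap.
subgame : {V : Set} (G : Game V) (p : Player) (U : NodeSet V) → IsTrap G p U → Game (Σ V U)
subgame G p U t = record
  { owner = λ x → owner G (proj₁ x)
  ; E     = λ x y → E G (proj₁ x) (proj₁ y)
  ; c     = λ x → c G (proj₁ x)
  ; total = λ x → let (w , e , u) = trapSucc G p U t (proj₁ x) (proj₂ x) in (w , u) , e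
  }

module Submission where

-- A p-trap U can only be left by moves of player 1-p, and
-- player p never needs such moves: every attractor witness of player p
-- stays inside U automatically, while for a node of player 1-p the subgame
-- G[U] only offers fewer successors, so the universal condition of mpre
-- survives restriction.
--
-- The
-- theorem `lemma3` is the instance p = c_K mod 2, d = c_K.

open import Defs
open import Data.Nat using (ℕ)
open import Data.Nat.DivMod using (_mod_)
open import Data.Fin using (Fin)
open import Data.Product using (Σ; _,_; proj₁)
open import Data.Sum using (_⊎_; inj₁; inj₂)
open import Relation.Binary.PropositionalEquality using (_≡_)

module _ {V : Set} (G : Game V) (p : Player) (U : NodeSet V)
         (trap : IsTrap G p U) (X : NodeSet V) (d : ℕ) where

  private
    H : Game (Σ V U)
    H = subgame G p U trap

    X∩U : NodeSet (Σ V U)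
    X∩U x = X (proj₁ x)

  mutual
    mattr-restrict : ∀ v → MAttr G p X d v → (u : U v) →
                     MAttr H p X∩U d (v , u)
    -- Player p's move stays in U because U is a p-trap.
    mattr-restrict v (mattr (inj₁ (own , col , w , e , hit))) u =
      let uw = proj₁ trap v u own w e
      in  mattr (inj₁ (own , col , (w , uw) , e , restrict-step w hit uw))
    -- Player 1-p's moves in G[U] are among its moves in G.
    mattr-restrict v (mattr (inj₂ (own , col , all))) u =
      mattr (inj₂ (own , col , λ { (w , uw) e → restrict-step w (all w e) uw }))

    restrict-step : ∀ w → MAttr G p X d w ⊎ X w → (uw : U w) →
                    MAttr H p X∩U d (w , uw) ⊎ X∩U (w , uw)
    restrict-step w (inj₁ a) uw = inj₁ (mattr-restrict w a uw)
    restrict-step w (inj₂ x) uw = inj₂ x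

lemma3 : (n : ℕ) (G : Game (Fin n)) (K : NodeSet (Fin n)) (cK : ℕ) →
         (∀ v → K v → c G v ≡ cK) →
         (U : NodeSet (Fin n)) (trap : IsTrap G (cK mod 2) U) →
         ∀ v → MAttr G (cK mod 2) K cK v → (u : U v) →
         MAttr (subgame G (cK mod 2) U trap) (cK mod 2) (λ x → K (proj₁ x)) cK (v , u)
lemma3 n G K cK _ U trap = mattr-restrict G (cK mod 2) U trap K cK
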